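{- Let $\xi$ be an unbounded graph width parameter that does not decrease when leaves are added to the graph. Then for every $k\in\mathbb{N}$ there is a graph $G$ with $\xi(G)\ge k$ such that the empty set is both a $\{Z,T\}$-forcing set and a $\{T,D\}$-forcing set of $G$.
   Context: A graph width parameter is a mapping $\xi$ from the class of all finite graphs to $\mathbb{N}$; it is unbounded if for every $k\in\mathbb{N}$ there is a graph $G$ with $\xi(G)\ge k$. "Does not decrease when leaves are added" means $\xi(G')\ge\xi(G)$ whenever $G'$ is obtained from $G$ by adding a new vertex adjacent to exactly one vertex of $G$. Vertices are colored blue or white. \emph{$Z$-rule}: if $v$ is blue and has exactly one white neighbor $w$, color $w$ blue. \emph{$T$-rule}: if $v$ is white and has exactly one white neighbor $w$, color $w$ blue. \emph{$D$-rule}: if $v$ is white and every neighbor of $v$ is blue, color $v$ blue. For a rule set $\mathcal{R}\subseteq\{Z,T,D\}$, a set $S\subseteq V(G)$ is an \emph{$\mathcal{R}$-forcing set} if, starting with $S$ blue and all other vertices white, iteratively applying rules from $\mathcal{R}$ can color all vertices blue. -}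

module Defs where

open import Data.Nat using (ℕ; zero; suc; _≤_)
open import Data.Fin using (Fin)
open import Data.Fin.Properties using (_≟_)
open import Data.Bool using (Bool; true; false)
open import Data.Product using (Σ; ∃; _×_; _,_)
open import Relation.Nullary.Decidable using (⌊_⌋)
open import Relation.Binary.PropositionalEquality using (_≡_; _≢_; refl)
open import Relation.Binary.Construct.Closure.ReflexiveTransitive using (Star)

record Graph : Set where
  field
    n     : ℕ
    adj   : Fin n → Fin n → Bool
    sym   : ∀ u v → adj u v ≡ adj v u
    irref : ∀ v → adj v v ≡ false
open Graph public

Adjacent : (G : Graph) → Fin (n G) → Fin (n G) → Set
Adjacent G u v = adj G u v ≡ true

WidthParameter : Set
WidthParameter = Graph → ℕ

Unbounded : WidthParameter → Set
Unbounded ξ = ∀ (k : ℕ) → Σ Graph λ G → k ≤ ξ G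

-- Adding a leaf: a new vertex (here Fin.zero; old vertex a becomes Fin.suc a)
-- adjacent to exactly one vertex v of G.
leafAdj : (G : Graph) → Fin (n G) → Fin (suc (n G)) → Fin (suc (n G)) → Bool
leafAdj G v Fin.zero    Fin.zero    = false
leafAdj G v Fin.zero    (Fin.suc b) = ⌊ b ≟ v ⌋
leafAdj G v (Fin.suc a) Fin.zero    = ⌊ a ≟ v ⌋
leafAdj G v (Fin.suc a) (Fin.suc b) = adj G a b

leafSym : (G : Graph) (v : Fin (n G)) → ∀ a b → leafAdj G v a b ≡ leafAdj G v b a
leafSym G v Fin.zero    Fin.zero    = refl
leafSym G v Fin.zero    (Fin.suc b) = refl
leafSym G v (Fin.suc a) Fin.zero    = refl
leafSym G v (Fin.suc a) (Fin.suc b) = sym G a b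

leafIrref : (G : Graph) (v : Fin (n G)) → ∀ a → leafAdj G v a a ≡ false
leafIrref G v Fin.zero    = refl
leafIrref G v (Fin.suc a) = irref G a

addLeaf : (G : Graph) → Fin (n G) → Graph
addLeaf G v = record
  { n = suc (n G) ; adj = leafAdj G v ; sym = leafSym G v ; irref = leafIrref G v }

LeafMonotone : WidthParameter → Set
LeafMonotone ξ = ∀ (G : Graph) (v : Fin (n G)) → ξ G ≤ ξ (addLeaf G v)

-- Colorings: true = blue, false = white.

Coloring : Graph → Set
Coloring G = Fin (n G) → Bool

colorBlue : (G : Graph) → Coloring G → Fin (n G) → Coloring G
colorBlue G c w x with x ≟ w
... | Relation.Nullary.Decidable.yes _ = true
... | Relation.Nullary.Decidable.no  _ = c x

UniqueWhiteNbr : (G : Graph) → Coloring G → Fin (n G) → Fin (n G) → Set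
UniqueWhiteNbr G c v w =
  Adjacent G v w × c w ≡ false ×
  (∀ u → Adjacent G v u → c u ≡ false → u ≡ w)

data Rule : Set where
  Z T D : Rule

data Step (G : Graph) : Rule → Coloring G → Coloring G → Set where
  zStep : ∀ {c} v w → c v ≡ true  → UniqueWhiteNbr G c v w →
          Step G Z c (colorBlue G c w)
  tStep : ∀ {c} v w → c v ≡ false → UniqueWhiteNbr G c v w →
          Step G T c (colorBlue G c w)
  dStep : ∀ {c} v → c v ≡ false → (∀ u → Adjacent G v u → c u ≡ true) →
          Step G D c (colorBlue G c v)

RuleSet : Set₁
RuleSet = Rule → Set

data ZT : Rule → Set where
  z : ZT Z
  t : ZT T

data TD : Rule → Set where
  t : TD T
  d : TD D

StepIn : (G : Graph) → RuleSet → Coloring G → Coloring G → Set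
StepIn G ℛ c c' = Σ Rule λ r → ℛ r × Step G r c c'

-- Initial coloring for a set S (as a predicate Fin n → Bool): S blue, rest white.
-- S is an ℛ-forcing set if iterating rules from ℛ can make every vertex blue.
IsForcingSet : (G : Graph) → RuleSet → (Fin (n G) → Bool) → Set
IsForcingSet G ℛ S =
  Σ (Coloring G) λ c → Star (StepIn G ℛ) S c × (∀ x → c x ≡ true)

emptySet : (G : Graph) → Fin (n G) → Bool
emptySet G _ = false

-- Attaching a pendant leaf to every vertex of a graph G (the corona of G) does not
-- decrease ξ. In the corona, the T-rule fired at each white leaf turns its neighbour
-- blue; once all original vertices are blue, every leaf is the unique white neighbour
-- of a blue vertex (Z-rule) and has only blue neighbours (D-rule). The corona is built
-- one leaf at a time, so the forcing sequence is maintained inductively: a new leaf at v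
-- first forces v and finally is forced itself, while all earlier forces run unchanged
-- in between because v is blue by then and never performs a Z-force.
module Submission where

open import Defs hiding (sym)
open import Data.Bool using (Bool; true; false; if_then_else_)
open import Data.Bool.Properties using (¬-not; T-≡) renaming (_≟_ to _≟ᵇ_)
open import Data.Fin using (Fin; zero; suc)
open import Data.Fin.Properties using (_≟_; suc-injective; any?)
open import Data.Nat using (ℕ; zero; suc; _+_; _≤_; _<_)
open import Data.Nat.Induction using (<-wellFounded)
open import Data.Nat.Properties using (≤-refl; ≤-trans; +-monoʳ-<)
open import Data.Product using (Σ; _×_; _,_)
open import Data.Sum using (_⊎_; inj₁; inj₂)
open import Data.Vec.Functional using (_∷_; head; tail; updateAt)
open import Data.Vec.Functional.Properties using (updateAt-updates; updateAt-minimal)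
open import Function using (const; _∘_)
open import Function.Bundles using (Equivalence)
open import Induction.WellFounded using (Acc; acc)
open import Relation.Binary.Construct.Closure.ReflexiveTransitive using (Star; ε; _◅_)
open import Relation.Binary.PropositionalEquality
  using (_≡_; _≢_; _≗_; refl; sym; trans; cong)
open import Relation.Nullary using (Dec; yes; no; contradiction)
open import Relation.Nullary.Decidable using (toWitness; fromWitness)

data AddsLeaf (G : Graph) : Graph → Set where
  addsLeaf : (v : Fin (n G)) → AddsLeaf G (addLeaf G v)

LeafMonotone⇒≤ : ∀ {ξ G H} → LeafMonotone ξ → Star AddsLeaf G H → ξ G ≤ ξ H
LeafMonotone⇒≤ mono ε                  = ≤-refl
LeafMonotone⇒≤ mono (addsLeaf v ◅ G↝H) = ≤-trans (mono _ v) (LeafMonotone⇒≤ mono G↝H)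

addLeaf-adjacent⇒≡ : ∀ {H v u} → Adjacent (addLeaf H v) (suc u) zero → u ≡ v
addLeaf-adjacent⇒≡ adj = toWitness (Equivalence.from T-≡ adj)

addLeaf-adjacent : ∀ H v → Adjacent (addLeaf H v) (suc v) zero
addLeaf-adjacent H v = Equivalence.to T-≡ (fromWitness refl)

colorBlue-self : ∀ G (c : Coloring G) {w x} → x ≡ w → colorBlue G c w x ≡ true
colorBlue-self G c {w} {x} x≡w with x ≟ w
... | yes _   = refl
... | no x≢w = contradiction x≡w x≢w

colorBlue-other : ∀ G (c : Coloring G) {w x} → x ≢ w → colorBlue G c w x ≡ c x
colorBlue-other G c {w} {x} x≢w with x ≟ w
... | yes x≡w = contradiction x≡w x≢w
... | no _    = refl

colorBlue-mono : ∀ G (c : Coloring G) w {x} → c x ≡ true → colorBlue G c w x ≡ true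
colorBlue-mono G c w {x} cx with x ≟ w
... | yes _ = refl
... | no _  = cx

colorBlue-cong : ∀ G {c d : Coloring G} w → c ≗ d → colorBlue G c w ≗ colorBlue G d w
colorBlue-cong G w c≗d x with x ≟ w
... | yes _ = refl
... | no _  = c≗d x

colorBlue-∷ : ∀ H v b (c : Coloring H) w →
              colorBlue (addLeaf H v) (b ∷ c) (suc w) ≗ b ∷ colorBlue H c w
colorBlue-∷ H v b c w zero = refl
colorBlue-∷ H v b c w (suc x) = byCases (x ≟ w)
  where
  byCases : Dec (x ≡ w) → colorBlue (addLeaf H v) (b ∷ c) (suc w) (suc x) ≡ colorBlue H c w x
  byCases (yes x≡w) = trans (colorBlue-self (addLeaf H v) (b ∷ c) (cong suc x≡w))
                            (sym (colorBlue-self H c x≡w))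
  byCases (no x≢w)  = trans (colorBlue-other (addLeaf H v) (b ∷ c) (x≢w ∘ suc-injective))
                            (sym (colorBlue-other H c x≢w))

_∖_ : ∀ {m} → (Fin m → Bool) → Fin m → Fin m → Bool
U ∖ v = updateAt U v (const false)

∖-false : ∀ {m} (U : Fin m → Bool) v {u} → U u ≡ false → (U ∖ v) u ≡ false
∖-false U v {u} Uu with u ≟ v
... | yes refl = updateAt-updates u U
... | no u≢v   = trans (updateAt-minimal u v U u≢v) Uu

colorBlue-∖ : ∀ G (U : Coloring G) v → U v ≡ true → colorBlue G (U ∖ v) v ≗ U
colorBlue-∖ G U v Uv x with x ≟ v
... | yes refl = sym Uv
... | no x≢v   = updateAt-minimal x v U x≢v

∣_∣ : ∀ {m} → (Fin m → Bool) → ℕ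
∣_∣ {zero}  U = 0
∣_∣ {suc m} U = (if head U then 1 else 0) + ∣ tail U ∣

∣∖∣< : ∀ {m} (U : Fin m → Bool) v → U v ≡ true → ∣ U ∖ v ∣ < ∣ U ∣
∣∖∣< U zero    Uv rewrite Uv = ≤-refl
∣∖∣< U (suc v) Uv = +-monoʳ-< (if head U then 1 else 0) (∣∖∣< (tail U) v Uv)

-- The vertices of U are those that will still receive a white leaf, which would
-- spoil any Z-force they perform; hence Z-forces from U are excluded.
data Completion (G : Graph) (ℛ : RuleSet) (U : Fin (n G) → Bool) : Coloring G → Set where
  allBlue : ∀ {c} → (∀ x → c x ≡ true) → Completion G ℛ U c
  forceT  : ∀ {c} u w → ℛ T → c u ≡ false → UniqueWhiteNbr G c u w →
            Completion G ℛ U (colorBlue G c w) → Completion G ℛ U c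
  forceZ  : ∀ {c} u w → ℛ Z → U u ≡ false → c u ≡ true → UniqueWhiteNbr G c u w →
            Completion G ℛ U (colorBlue G c w) → Completion G ℛ U c
  forceD  : ∀ {c} u → ℛ D → c u ≡ false → (∀ x → Adjacent G u x → c x ≡ true) →
            Completion G ℛ U (colorBlue G c u) → Completion G ℛ U c

Completion⇒IsForcingSet : ∀ {G ℛ U c} → Completion G ℛ U c → IsForcingSet G ℛ c
Completion⇒IsForcingSet (allBlue blue) = _ , ε , blue
Completion⇒IsForcingSet (forceT u w ℛT cu unique rest)
  with c′ , steps , blue ← Completion⇒IsForcingSet rest
  = c′ , (T , ℛT , tStep u w cu unique) ◅ steps , blue
Completion⇒IsForcingSet (forceZ u w ℛZ _ cu unique rest)
  with c′ , steps , blue ← Completion⇒IsForcingSet rest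
  = c′ , (Z , ℛZ , zStep u w cu unique) ◅ steps , blue
Completion⇒IsForcingSet (forceD u ℛD cu blueNbrs rest)
  with c′ , steps , blue ← Completion⇒IsForcingSet rest
  = c′ , (D , ℛD , dStep u cu blueNbrs) ◅ steps , blue

UniqueWhiteNbr-cong : ∀ G {c d u w} → c ≗ d → UniqueWhiteNbr G c u w → UniqueWhiteNbr G d u w
UniqueWhiteNbr-cong G {w = w} c≗d (adjW , cw , unique) =
  adjW , trans (sym (c≗d w)) cw , λ x adjX dx → unique x adjX (trans (c≗d x) dx)

Completion-cong : ∀ {G ℛ U c d} → c ≗ d → Completion G ℛ U c → Completion G ℛ U d
Completion-cong c≗d (allBlue blue) = allBlue (λ x → trans (sym (c≗d x)) (blue x))
Completion-cong {G} c≗d (forceT u w ℛT cu unique rest) =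
  forceT u w ℛT (trans (sym (c≗d u)) cu) (UniqueWhiteNbr-cong G c≗d unique)
    (Completion-cong (colorBlue-cong G w c≗d) rest)
Completion-cong {G} c≗d (forceZ u w ℛZ Uu cu unique rest) =
  forceZ u w ℛZ Uu (trans (sym (c≗d u)) cu) (UniqueWhiteNbr-cong G c≗d unique)
    (Completion-cong (colorBlue-cong G w c≗d) rest)
Completion-cong {G} c≗d (forceD u ℛD cu blueNbrs rest) =
  forceD u ℛD (trans (sym (c≗d u)) cu) (λ x adj → trans (sym (c≗d x)) (blueNbrs x adj))
    (Completion-cong (colorBlue-cong G u c≗d) rest)

≢-by : ∀ {A : Set} (f : A → Bool) {x y} → f x ≡ false → f y ≡ true → x ≢ y
≢-by f fx fy refl = contradiction (trans (sym fx) fy) λ ()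

UniqueWhiteNbr-addLeaf : ∀ {H v c u w} b → u ≢ v → UniqueWhiteNbr H c u w →
                         UniqueWhiteNbr (addLeaf H v) (b ∷ c) (suc u) (suc w)
UniqueWhiteNbr-addLeaf {H} {v} {c} {u} {w} b u≢v (adjW , cw , unique) = adjW , cw , unique′
  where
  unique′ : ∀ x → Adjacent (addLeaf H v) (suc u) x → (b ∷ c) x ≡ false → x ≡ suc w
  unique′ zero    adj _  = contradiction (addLeaf-adjacent⇒≡ {H} adj) u≢v
  unique′ (suc x) adj cx = cong suc (unique x adj cx)

Completion-colorBlue-∷ : ∀ {H v ℛ U′ c} b w →
  Completion (addLeaf H v) ℛ U′ (b ∷ colorBlue H c w) →
  Completion (addLeaf H v) ℛ U′ (colorBlue (addLeaf H v) (b ∷ c) (suc w))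
Completion-colorBlue-∷ {H} {v} {c = c} b w = Completion-cong (sym ∘ colorBlue-∷ H v b c w)

Completion-whiteLeaf : ∀ {H ℛ U c} v → ℛ Z ⊎ ℛ D → U v ≡ true → c v ≡ true →
  Completion H ℛ U c → Completion (addLeaf H v) ℛ (false ∷ (U ∖ v)) (false ∷ c)
Completion-whiteLeaf {H} {ℛ} {U} {c} v leafRule Uv cv (allBlue blue) = forceLeaf leafRule
  where
  H′ : Graph
  H′ = addLeaf H v
  leafBlue : ∀ x → colorBlue H′ (false ∷ c) zero x ≡ true
  leafBlue zero    = refl
  leafBlue (suc x) = blue x
  forceLeaf : ℛ Z ⊎ ℛ D → Completion H′ ℛ (false ∷ (U ∖ v)) (false ∷ c)
  forceLeaf (inj₁ ℛZ) =
    forceZ (suc v) zero ℛZ (updateAt-updates v U) cv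
      (addLeaf-adjacent H v , refl , onlyLeaf) (allBlue leafBlue)
    where
    onlyLeaf : ∀ x → Adjacent H′ (suc v) x → (false ∷ c) x ≡ false → x ≡ zero
    onlyLeaf zero    _ _  = refl
    onlyLeaf (suc x) _ cx = contradiction (trans (sym (blue x)) cx) λ ()
  forceLeaf (inj₂ ℛD) = forceD zero ℛD refl blueNbrs (allBlue leafBlue)
    where
    blueNbrs : ∀ x → Adjacent H′ zero x → (false ∷ c) x ≡ true
    blueNbrs zero    ()
    blueNbrs (suc x) _ = blue x
Completion-whiteLeaf {H} {c = c} v leafRule Uv cv (forceT u w ℛT cu unique rest) =
  forceT (suc u) (suc w) ℛT cu (UniqueWhiteNbr-addLeaf false (≢-by c cu cv) unique)
    (Completion-colorBlue-∷ false w
      (Completion-whiteLeaf v leafRule Uv (colorBlue-mono H c w cv) rest))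
Completion-whiteLeaf {H} {U = U} {c} v leafRule Uv cv (forceZ u w ℛZ Uu cu unique rest) =
  forceZ (suc u) (suc w) ℛZ (∖-false U v Uu) cu
    (UniqueWhiteNbr-addLeaf false (≢-by U Uu Uv) unique)
    (Completion-colorBlue-∷ false w
      (Completion-whiteLeaf v leafRule Uv (colorBlue-mono H c w cv) rest))
Completion-whiteLeaf {H} {c = c} v leafRule Uv cv (forceD u ℛD cu blueNbrs rest) =
  forceD (suc u) ℛD cu blueNbrs′
    (Completion-colorBlue-∷ false u
      (Completion-whiteLeaf v leafRule Uv (colorBlue-mono H c u cv) rest))
  where
  blueNbrs′ : ∀ x → Adjacent (addLeaf H v) (suc u) x → (false ∷ c) x ≡ true
  blueNbrs′ zero    adj = contradiction (addLeaf-adjacent⇒≡ {H} adj) (≢-by c cu cv)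
  blueNbrs′ (suc x) adj = blueNbrs x adj

CoronaRules : RuleSet → Set
CoronaRules ℛ = ℛ T × (ℛ Z ⊎ ℛ D)

Completion-addLeaf : ∀ {H ℛ U} v → CoronaRules ℛ → U v ≡ true → Completion H ℛ U U →
  Completion (addLeaf H v) ℛ (false ∷ (U ∖ v)) (false ∷ (U ∖ v))
Completion-addLeaf {H} {U = U} v (ℛT , leafRule) Uv completion =
  forceT zero (suc v) ℛT refl (addLeaf-adjacent H v , updateAt-updates v U , onlyV)
    (Completion-cong vForced (Completion-whiteLeaf v leafRule Uv Uv completion))
  where
  H′ : Graph
  H′ = addLeaf H v
  onlyV : ∀ x → Adjacent H′ zero x → (false ∷ (U ∖ v)) x ≡ false → x ≡ suc v
  onlyV zero    ()
  onlyV (suc x) adj _ = cong suc (addLeaf-adjacent⇒≡ {H} adj)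
  vForced : (false ∷ U) ≗ colorBlue H′ (false ∷ (U ∖ v)) (suc v)
  vForced zero    = refl
  vForced (suc x) =
    sym (trans (colorBlue-∷ H v false (U ∖ v) v (suc x)) (colorBlue-∖ H U v Uv x))

LeafExtensionWithEmptyForcingSet : Graph → Set₁
LeafExtensionWithEmptyForcingSet G =
  Σ Graph λ H → Star AddsLeaf G H × (∀ {ℛ} → CoronaRules ℛ → IsForcingSet H ℛ (emptySet H))

attachLeaves : ∀ H (U : Fin (n H) → Bool) → Acc _<_ ∣ U ∣ →
  (∀ {ℛ} → CoronaRules ℛ → Completion H ℛ U U) → LeafExtensionWithEmptyForcingSet H
attachLeaves H U (acc smaller) completion with any? (λ x → U x ≟ᵇ true)
... | no noneLeft = H , ε , λ rules →
  Completion⇒IsForcingSet (Completion-cong (λ x → ¬-not (noneLeft ∘ (x ,_))) (completion rules))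
... | yes (v , Uv)
  with H′ , H+v↝H′ , forcing ← attachLeaves (addLeaf H v) (false ∷ (U ∖ v)) (smaller (∣∖∣< U v Uv))
                                   (λ rules → Completion-addLeaf v rules Uv (completion rules))
  = H′ , addsLeaf v ◅ H+v↝H′ , forcing

leafExtensionWithEmptyForcingSet : ∀ G → LeafExtensionWithEmptyForcingSet G
leafExtensionWithEmptyForcingSet G =
  attachLeaves G (const true) (<-wellFounded _) (λ _ → allBlue (λ _ → refl))

proposition33 : (ξ : WidthParameter) → Unbounded ξ → LeafMonotone ξ →
    ∀ (k : ℕ) → Σ Graph λ G →
      k ≤ ξ G × IsForcingSet G ZT (emptySet G) × IsForcingSet G TD (emptySet G)
proposition33 ξ unbounded leafMonotone k
  with G , k≤ξG ← unbounded k
  with H , G↝H , forcing ← leafExtensionWithEmptyForcingSet G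
  = H , ≤-trans k≤ξG (LeafMonotone⇒≤ leafMonotone G↝H) , forcing (t , inj₁ z) , forcing (t , inj₂ d)
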